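{- Let $G$ be a finite connected simple graph. The complex $\Delta(\overrightarrow{G})$ is pure if and only if $\operatorname{diam}(G)\leqslant 2$.
   Context: $\overrightarrow{G}$ is the directed graph obtained from $G$ by replacing every edge $xy$ with the two directed edges $\overrightarrow{xy}$ and $\overrightarrow{yx}$. For a directed graph $D$, $\Delta(D)$ is the simplicial complex whose vertices are the directed edges of $D$ and whose faces are the edge sets of directed forests (families of vertex-disjoint rooted directed trees) contained in $D$. A complex is pure if all its maximal faces have the same dimension. $\operatorname{diam}(G)$ is the greatest distance between two vertices of $G$. -}

module Defs where

open import Data.Nat using (ℕ; zero; suc; _+_; _≤_)
open import Data.Fin using (Fin)
open import Data.Bool using (Bool; true; false)
open import Data.Product using (Σ; _×_; ∃-syntax)
open import Data.List using (List; map; concatMap)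
open import Data.Nat.ListAction using (sum)
open import Data.List using (allFin)
open import Relation.Binary.PropositionalEquality using (_≡_)
open import Relation.Binary.Construct.Closure.Transitive using (TransClosure)
open import Relation.Nullary using (¬_)

record SimpleGraph (n : ℕ) : Set where
  field
    adj     : Fin n → Fin n → Bool
    symm    : ∀ x y → adj x y ≡ true → adj y x ≡ true
    irrefl  : ∀ x → adj x x ≡ false
open SimpleGraph public

data Walk {n : ℕ} (G : SimpleGraph n) : Fin n → Fin n → ℕ → Set where
  here : ∀ {x} → Walk G x x zero
  step : ∀ {x y z k} → adj G x y ≡ true → Walk G y z k → Walk G x z (suc k)

DistLe : {n : ℕ} → SimpleGraph n → Fin n → Fin n → ℕ → Set
DistLe G x y d = ∃[ k ] (k ≤ d × Walk G x y k)

Connected : {n : ℕ} → SimpleGraph n → Set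
Connected {n} G = (1 ≤ n) × (∀ x y → ∃[ k ] Walk G x y k)

DiamLe : {n : ℕ} → SimpleGraph n → ℕ → Set
DiamLe G d = ∀ x y → DistLe G x y d

DEdgeSet : ℕ → Set
DEdgeSet n = Fin n → Fin n → Bool

_∈ᵈ_ : {n : ℕ} → Fin n × Fin n → DEdgeSet n → Set
_∈ᵈ_ (x Data.Product., y) F = F x y ≡ true

_⊆ᵈ_ : {n : ℕ} → DEdgeSet n → DEdgeSet n → Set
F ⊆ᵈ F' = ∀ x y → F x y ≡ true → F' x y ≡ true

bit : Bool → ℕ
bit true = 1
bit false = 0

card : {n : ℕ} → DEdgeSet n → ℕ
card {n} F = sum (concatMap (λ x → map (λ y → bit (F x y)) (allFin n)) (allFin n))

-- The doubled digraph G⃗: edge x→y iff xy ∈ E(G).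
-- (Its edge set is just adj G, viewed as a set of ordered pairs.)
InDoubled : {n : ℕ} → SimpleGraph n → DEdgeSet n → Set
InDoubled G F = F ⊆ᵈ adj G

Arc : {n : ℕ} → DEdgeSet n → Fin n → Fin n → Set
Arc F x y = F x y ≡ true

-- A directed forest (disjoint union of rooted directed trees, edges oriented
-- away from the roots): every vertex has in-degree ≤ 1 and there is no
-- directed cycle.
DirectedForest : {n : ℕ} → DEdgeSet n → Set
DirectedForest {n} F =
  (∀ x x' y → F x y ≡ true → F x' y ≡ true → x ≡ x')
  × (∀ x → ¬ TransClosure (Arc F) x x)

Face : {n : ℕ} → SimpleGraph n → DEdgeSet n → Set
Face G F = InDoubled G F × DirectedForest F

MaximalFace : {n : ℕ} → SimpleGraph n → DEdgeSet n → Set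
MaximalFace G F = Face G F × (∀ F' → Face G F' → F ⊆ᵈ F' → F' ⊆ᵈ F)

-- Δ(G⃗) is pure: all maximal faces have the same number of elements
-- (equivalently, the same dimension).
PureDoubled : {n : ℕ} → SimpleGraph n → Set
PureDoubled G = ∀ F F' → MaximalFace G F → MaximalFace G F' → card F ≡ card F'

module Submission where

-- Counting: in a face every in-degree is ≤ 1, so |F| = Σ_y indeg y = n − #roots.
-- (⇐) In a maximal face a root r reaches each neighbour w (else the arc w → r
-- could be added).  If diam G ≤ 2, two roots are adjacent or share a neighbour
-- reached from both; paths into a common vertex converge (in-degree ≤ 1), giving
-- a path into a root.  So a maximal face has one root and n − 1 arcs.
-- (⇒) If d(x,y) ≥ 3, the arcs out of x and y form a face; a maximal face
-- containing it has roots x, y, hence ≤ n − 2 arcs, while a spanning tree grown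
-- from a vertex is a maximal face with n − 1 arcs.  Both are reached by adding
-- arcs one at a time; "F can be enlarged" is undecidable here, so this runs in
-- the double-negation monad, enough since the goal is ⊥.

open import Defs
open import Data.Nat using (ℕ; zero; suc; _+_; _∸_; _≤_; _<_; z≤n; s≤s)
open import Data.Nat.Properties
  using (+-0-commutativeMonoid; +-mono-≤; +-mono-<-≤; +-mono-≤-<; +-monoˡ-≤; +-suc; +-identityʳ;
         ≤-reflexive; <-≤-trans; ≤⇒≯; m≤n+m; 1+n≰n; suc-injective; n<1+n; m∸n+n≡m)
open import Data.Fin using (Fin; zero; suc; toℕ; punchIn; punchOut)
open import Data.Fin.Properties using (_≟_; any?; all?; ¬∀⟶∃¬; pigeonhole; punchInᵢ≢i; punchIn-punchOut)
open import Data.Bool using (true; false)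
open import Data.Bool.Properties using (¬-not) renaming (_≟_ to _≟ᵇ_)
open import Data.Product using (_×_; _,_; proj₁; proj₂; ∃-syntax)
open import Data.Sum using (_⊎_; inj₁; inj₂)
open import Data.Empty using (⊥; ⊥-elim)
open import Data.List using (List; []; _∷_; map; concatMap; allFin; tabulate)
open import Data.List.Properties using (map-tabulate)
open import Data.Nat.ListAction using () renaming (sum to listSum)
open import Data.Nat.ListAction.Properties using (sum-++)
open import Function using (_∘_)
open import Relation.Binary.PropositionalEquality
open import Relation.Binary.Construct.Closure.Transitive using (TransClosure; [_]; _∷_; _∷ʳ_) renaming (_++_ to _⁺++_)
open import Relation.Nullary using (¬_; Dec; yes; no)
open import Relation.Nullary.Decidable using (_×-dec_; decidable-stable; ¬¬-excluded-middle)
open import Relation.Nullary.Negation using (¬¬-Monad; ¬¬-map)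
open import Effect.Monad using (RawMonad)
open import Level using (0ℓ)
open import Algebra.Properties.CommutativeMonoid.Sum +-0-commutativeMonoid
  using (sum; sum-syntax; sum-remove; sum-cong-≗; sum-replicate-zero; ∑-comm)

-- Case distinctions on undecidable statements are made in the ¬¬ monad.
open RawMonad (¬¬-Monad {0ℓ}) using (_>>=_; pure)

¬¬-∀Fin : ∀ {m} {P : Fin m → Set} → (∀ i → ¬ ¬ P i) → ¬ ¬ (∀ i → P i)
¬¬-∀Fin {zero}  h k = k (λ ())
¬¬-∀Fin {suc m} h k = h zero λ p₀ → ¬¬-∀Fin (h ∘ suc) λ ps → k λ where
  zero    → p₀
  (suc i) → ps i

∑-mono : ∀ {n} {f g : Fin n → ℕ} → (∀ i → f i ≤ g i) → sum f ≤ sum g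
∑-mono {zero}  f≤g = z≤n
∑-mono {suc n} f≤g = +-mono-≤ (f≤g zero) (∑-mono (f≤g ∘ suc))

∑-mono-< : ∀ {n} {f g : Fin n → ℕ} → (∀ i → f i ≤ g i) → ∀ k → f k < g k → sum f < sum g
∑-mono-< f≤g zero    fk<gk = +-mono-<-≤ fk<gk (∑-mono (f≤g ∘ suc))
∑-mono-< f≤g (suc k) fk<gk = +-mono-≤-< (f≤g zero) (∑-mono-< (f≤g ∘ suc) k fk<gk)

∑-≤1 : ∀ {n} {c : Fin n → ℕ} → (∀ i → c i ≤ 1) → sum c ≤ n
∑-≤1 {zero}  c≤1 = z≤n
∑-≤1 {suc n} c≤1 = +-mono-≤ (c≤1 zero) (∑-≤1 (c≤1 ∘ suc))

∑-ones : ∀ {n} {c : Fin n → ℕ} → (∀ i → c i ≡ 1) → sum c ≡ n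
∑-ones {zero}  c≡1 = refl
∑-ones {suc n} c≡1 = cong₂ _+_ (c≡1 zero) (∑-ones (c≡1 ∘ suc))

∑-zeros : ∀ {n} {c : Fin n → ℕ} → (∀ i → c i ≡ 0) → sum c ≡ 0
∑-zeros {n} c≡0 = trans (sum-cong-≗ c≡0) (sum-replicate-zero n)

∑-single : ∀ {n} {c : Fin n → ℕ} p → (∀ i → i ≢ p → c i ≡ 0) → sum c ≡ c p
∑-single {suc n} {c} p others = begin
  sum c                        ≡⟨ sum-remove {i = p} c ⟩
  c p + sum (c ∘ punchIn p)    ≡⟨ cong (c p +_) (∑-zeros (λ i → others (punchIn p i) (punchInᵢ≢i p i))) ⟩
  c p + 0                      ≡⟨ +-identityʳ (c p) ⟩
  c p                          ∎
  where open ≡-Reasoning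

∑-removeZero : ∀ {n} (c : Fin (suc n) → ℕ) {r} → c r ≡ 0 → sum c ≡ sum (c ∘ punchIn r)
∑-removeZero c {r} cr≡0 = trans (sum-remove {i = r} c) (cong (_+ sum (c ∘ punchIn r)) cr≡0)

∑-oneZero : ∀ {n} {c : Fin n → ℕ} → (∀ i → c i ≤ 1) → ∀ r → c r ≡ 0 → suc (sum c) ≤ n
∑-oneZero {suc n} {c} c≤1 r cr≡0 =
  s≤s (subst (_≤ n) (sym (∑-removeZero c cr≡0)) (∑-≤1 (c≤1 ∘ punchIn r)))

∑-twoZeros : ∀ {n} {c : Fin n → ℕ} → (∀ i → c i ≤ 1) → ∀ {x y} → x ≢ y →
             c x ≡ 0 → c y ≡ 0 → 2 + sum c ≤ n
∑-twoZeros {suc n} {c} c≤1 {x} x≢y cx≡0 cy≡0 =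
  s≤s (subst (λ s → suc s ≤ n) (sym (∑-removeZero c cx≡0))
        (∑-oneZero (c≤1 ∘ punchIn x) (punchOut x≢y) (trans (cong c (punchIn-punchOut x≢y)) cy≡0)))

∑-exactlyOneZero : ∀ {n} {c : Fin n → ℕ} r → c r ≡ 0 → (∀ i → i ≢ r → c i ≡ 1) → suc (sum c) ≡ n
∑-exactlyOneZero {suc n} {c} r cr≡0 others =
  cong suc (trans (∑-removeZero c cr≡0) (∑-ones (λ i → others (punchIn r i) (punchInᵢ≢i r i))))

listSum-tabulate : ∀ {n} (f : Fin n → ℕ) → listSum (tabulate f) ≡ sum f
listSum-tabulate {zero}  f = refl
listSum-tabulate {suc n} f = cong (f zero +_) (listSum-tabulate (f ∘ suc))

listSum-allFin : ∀ {n} (f : Fin n → ℕ) → listSum (map f (allFin n)) ≡ sum f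
listSum-allFin f = trans (cong listSum (map-tabulate (λ i → i) f)) (listSum-tabulate f)

listSum-concatMap : ∀ {A : Set} (g : A → List ℕ) xs →
                    listSum (concatMap g xs) ≡ listSum (map (listSum ∘ g) xs)
listSum-concatMap g []       = refl
listSum-concatMap g (x ∷ xs) =
  trans (sum-++ (g x) (concatMap g xs)) (cong (listSum (g x) +_) (listSum-concatMap g xs))

card-∑ : ∀ {n} (F : DEdgeSet n) → card F ≡ ∑[ x < n ] ∑[ y < n ] bit (F x y)
card-∑ {n} F = begin
  card F                                                      ≡⟨ listSum-concatMap row (allFin n) ⟩
  listSum (map (listSum ∘ row) (allFin n))                     ≡⟨ listSum-allFin (listSum ∘ row) ⟩
  ∑[ x < n ] listSum (row x)                                   ≡⟨ sum-cong-≗ (λ x → listSum-allFin (λ y → bit (F x y))) ⟩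
  ∑[ x < n ] ∑[ y < n ] bit (F x y)                            ∎
  where
  open ≡-Reasoning
  row : Fin n → List ℕ
  row x = map (λ y → bit (F x y)) (allFin n)

bit-false : ∀ {b} → b ≢ true → bit b ≡ 0
bit-false {false} _  = refl
bit-false {true}  ¬t = ⊥-elim (¬t refl)

bit-mono : ∀ {a b} → (a ≡ true → b ≡ true) → bit a ≤ bit b
bit-mono {false} _   = z≤n
bit-mono {true}  a⇒b rewrite a⇒b refl = s≤s z≤n

module _ {n : ℕ} where

  Path : DEdgeSet n → Fin n → Fin n → Set
  Path F = TransClosure (Arc F)

  Reach : DEdgeSet n → Fin n → Fin n → Set
  Reach F x y = x ≡ y ⊎ Path F x y

  Root : DEdgeSet n → Fin n → Set
  Root F r = ∀ x → ¬ Arc F x r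

  InDeg≤1 : DEdgeSet n → Set
  InDeg≤1 F = ∀ x x' y → F x y ≡ true → F x' y ≡ true → x ≡ x'

  Acyclic : DEdgeSet n → Set
  Acyclic F = ∀ x → ¬ Path F x x

  parent? : (F : DEdgeSet n) (y : Fin n) → Dec (∃[ p ] Arc F p y)
  parent? F y = any? (λ p → F p y ≟ᵇ true)

  parentOf : ∀ {F y} → ¬ Root F y → ∃[ p ] Arc F p y
  parentOf {F} {y} ¬root = decidable-stable (parent? F y) (λ noParent → ¬root (λ x e → noParent (x , e)))

  indeg : DEdgeSet n → Fin n → ℕ
  indeg F y = ∑[ x < n ] bit (F x y)

  indeg-root : ∀ {F y} → Root F y → indeg F y ≡ 0
  indeg-root root = ∑-zeros (λ x → bit-false (root x))

  indeg-arc : ∀ {F p y} → InDeg≤1 F → Arc F p y → indeg F y ≡ 1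
  indeg-arc {F} {p} {y} d e =
    trans (∑-single p (λ x x≢p → bit-false (λ e' → x≢p (d x p y e' e)))) (cong bit e)

  indeg≤1 : ∀ {F} → InDeg≤1 F → ∀ y → indeg F y ≤ 1
  indeg≤1 {F} d y with parent? F y
  ... | yes (p , e)  = ≤-reflexive (indeg-arc d e)
  ... | no noParent = subst (_≤ 1) (sym (indeg-root {F} (λ x e → noParent (x , e)))) z≤n

  card-indeg : ∀ F → card F ≡ ∑[ y < n ] indeg F y
  card-indeg F = trans (card-∑ F) (∑-comm (λ x y → bit (F x y)))

  card≤n : ∀ {F} → InDeg≤1 F → card F ≤ n
  card≤n {F} d = subst (_≤ n) (sym (card-indeg F)) (∑-≤1 (indeg≤1 d))

  card-< : ∀ {F F'} → F ⊆ᵈ F' → ∀ u v → F' u v ≡ true → F u v ≡ false → card F < card F'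
  card-< {F} {F'} F⊆F' u v e' e =
    subst₂ _<_ (sym (card-indeg F)) (sym (card-indeg F'))
      (∑-mono-< (λ y → ∑-mono (λ x → bit-mono (F⊆F' x y))) v
        (∑-mono-< (λ x → bit-mono (F⊆F' x v)) u
          (subst₂ (λ a b → bit a < bit b) (sym e) (sym e') (s≤s z≤n))))

  -- n − |F| is the number of roots: one root gives n − 1 arcs, two give ≤ n − 2.
  card-oneRoot : ∀ {F r} → InDeg≤1 F → Root F r → (∀ y → y ≢ r → ∃[ p ] Arc F p y) → suc (card F) ≡ n
  card-oneRoot {F} d root parent =
    trans (cong suc (card-indeg F))
          (∑-exactlyOneZero _ (indeg-root {F} root) (λ y y≢r → indeg-arc {F} d (proj₂ (parent y y≢r))))

  card-twoRoots : ∀ {F x y} → InDeg≤1 F → x ≢ y → Root F x → Root F y → 2 + card F ≤ n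
  card-twoRoots {F} d x≢y rootx rooty =
    subst (λ s → 2 + s ≤ n) (sym (card-indeg F))
      (∑-twoZeros (indeg≤1 d) x≢y (indeg-root {F} rootx) (indeg-root {F} rooty))

  mapPath : ∀ {F F'} → F ⊆ᵈ F' → ∀ {x y} → Path F x y → Path F' x y
  mapPath F⊆F' [ e ]   = [ F⊆F' _ _ e ]
  mapPath F⊆F' (e ∷ p) = F⊆F' _ _ e ∷ mapPath F⊆F' p

  mapReach : ∀ {F F'} → F ⊆ᵈ F' → ∀ {x y} → Reach F x y → Reach F' x y
  mapReach F⊆F' (inj₁ x≡y) = inj₁ x≡y
  mapReach F⊆F' (inj₂ p)   = inj₂ (mapPath F⊆F' p)

  firstArc : ∀ {F x z} → Path F x z → ∃[ y ] Arc F x y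
  firstArc [ e ]   = _ , e
  firstArc (e ∷ _) = _ , e

  unsnoc : ∀ {F x z} → Path F x z → Arc F x z ⊎ ∃[ y ] (Path F x y × Arc F y z)
  unsnoc [ e ] = inj₁ e
  unsnoc (e ∷ p) with unsnoc p
  ... | inj₁ e'           = inj₂ (_ , [ e ] , e')
  ... | inj₂ (y , q , e') = inj₂ (y , e ∷ q , e')

  lastArc : ∀ {F x z} → Path F x z → ∃[ y ] Arc F y z
  lastArc p with unsnoc p
  ... | inj₁ e           = _ , e
  ... | inj₂ (y , _ , e) = y , e

  noPathToRoot : ∀ {F r x} → Root F r → ¬ Path F x r
  noPathToRoot root p = root _ (proj₂ (lastArc p))

  reach-trans : ∀ {F x y z} → Reach F x y → Reach F y z → Reach F x z
  reach-trans (inj₁ refl) r       = r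
  reach-trans (inj₂ p) (inj₁ refl) = inj₂ p
  reach-trans (inj₂ p) (inj₂ q)    = inj₂ (p ⁺++ q)

  reach-snoc : ∀ {F x y z} → Reach F x y → Arc F y z → Path F x z
  reach-snoc (inj₁ refl) e = [ e ]
  reach-snoc (inj₂ p)    e = p ∷ʳ e

  converge₁ : ∀ {F a b w} → InDeg≤1 F → Arc F a w → Path F b w → a ≡ b ⊎ Path F b a
  converge₁ d e q with unsnoc q
  ... | inj₁ e' = inj₁ (d _ _ _ e e')
  ... | inj₂ (c , q' , e') with d _ _ _ e e'
  ...   | refl = inj₂ q'

  converge : ∀ {F a b w} → InDeg≤1 F → Path F a w → Path F b w → a ≡ b ⊎ (Path F a b ⊎ Path F b a)
  converge d [ e ] q with converge₁ d e q
  ... | inj₁ a≡b = inj₁ a≡b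
  ... | inj₂ q'  = inj₂ (inj₂ q')
  converge d (e ∷ p) q with converge d p q
  ... | inj₁ refl           = inj₂ (inj₁ [ e ])
  ... | inj₂ (inj₁ p')      = inj₂ (inj₁ (e ∷ p'))
  ... | inj₂ (inj₂ q') with converge₁ d e q'
  ...   | inj₁ a≡b = inj₁ a≡b
  ...   | inj₂ q'' = inj₂ (inj₂ q'')

  roots-converge : ∀ {F r₁ r₂ w} → InDeg≤1 F → Root F r₁ → Root F r₂ →
                   Path F r₁ w → Path F r₂ w → r₁ ≡ r₂
  roots-converge d root₁ root₂ p q with converge d p q
  ... | inj₁ r₁≡r₂      = r₁≡r₂
  ... | inj₂ (inj₁ p')  = ⊥-elim (noPathToRoot root₂ p')
  ... | inj₂ (inj₂ q')  = ⊥-elim (noPathToRoot root₁ q')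

  -- An acyclic digraph on a nonempty vertex set has a root: otherwise, iterating a
  -- parent function n + 1 times from any vertex repeats a vertex (pigeonhole),
  -- which closes a cycle.
  module ParentChain (F : DEdgeSet n) (par : Fin n → Fin n) (par-arc : ∀ y → Arc F (par y) y) where

    iter : ℕ → Fin n → Fin n
    iter zero    z = z
    iter (suc m) z = par (iter m z)

    iter-+ : ∀ m k z → iter (m + k) z ≡ iter m (iter k z)
    iter-+ zero    k z = refl
    iter-+ (suc m) k z = cong par (iter-+ m k z)

    iter-path : ∀ m z → Path F (iter (suc m) z) z
    iter-path zero    z = [ par-arc z ]
    iter-path (suc m) z = par-arc (iter (suc m) z) ∷ iter-path m z

    cycle : Fin n → ∃[ x ] Path F x x
    cycle z with pigeonhole (n<1+n n) (λ i → iter (toℕ i) z)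
    ... | i , j , i<j , iterᵢ≡iterⱼ = w , subst (λ t → Path F t w) loop (iter-path d w)
      where
      d = toℕ j ∸ suc (toℕ i)
      w = iter (toℕ i) z
      loop : iter (suc d) w ≡ w
      loop = begin
        iter (suc d) w              ≡⟨ iter-+ (suc d) (toℕ i) z ⟨
        iter (suc d + toℕ i) z      ≡⟨ cong (λ t → iter t z) (trans (sym (+-suc d (toℕ i))) (m∸n+n≡m i<j)) ⟩
        iter (toℕ j) z              ≡⟨ iterᵢ≡iterⱼ ⟨
        w                           ∎
        where open ≡-Reasoning

  rootExists : ∀ {F} → Acyclic F → Fin n → ∃[ r ] Root F r
  rootExists {F} acyclic z with all? (parent? F)
  ... | no ¬allParents = let r , noParent = ¬∀⟶∃¬ n _ (parent? F) ¬allParents in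
                         r , λ x e → noParent (x , e)
  ... | yes allParents = let x , c = ParentChain.cycle F (proj₁ ∘ allParents) (proj₂ ∘ allParents) z in
                         ⊥-elim (acyclic x c)

  addArc : DEdgeSet n → Fin n → Fin n → DEdgeSet n
  addArc F u v a b with a ≟ u | b ≟ v
  ... | yes _ | yes _ = true
  ... | _     | _     = F a b

  addArc-cases : ∀ F u v a b → addArc F u v a b ≡ true → (a ≡ u × b ≡ v) ⊎ F a b ≡ true
  addArc-cases F u v a b e with a ≟ u | b ≟ v
  ... | yes a≡u | yes b≡v = inj₁ (a≡u , b≡v)
  ... | yes _   | no _    = inj₂ e
  ... | no _    | _       = inj₂ e

  addArc-new : ∀ F u v → addArc F u v u v ≡ true
  addArc-new F u v with u ≟ u | v ≟ v
  ... | yes _ | yes _ = refl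
  ... | no u≢u | _    = ⊥-elim (u≢u refl)
  ... | yes _ | no v≢v = ⊥-elim (v≢v refl)

  addArc-old : ∀ F u v → F ⊆ᵈ addArc F u v
  addArc-old F u v a b e with a ≟ u | b ≟ v
  ... | yes _ | yes _ = refl
  ... | yes _ | no _  = e
  ... | no _  | _     = e

  path-addArc : ∀ F u v {x y} → Path (addArc F u v) x y → Path F x y ⊎ (Reach F x u × Reach F v y)
  path-addArc F u v {x} {y} [ e ] with addArc-cases F u v x y e
  ... | inj₁ (refl , refl) = inj₂ (inj₁ refl , inj₁ refl)
  ... | inj₂ e'            = inj₁ [ e' ]
  path-addArc F u v {x} (_∷_ {y = z} e p) with addArc-cases F u v x z e | path-addArc F u v p
  ... | inj₂ e'            | inj₁ q          = inj₁ (e' ∷ q)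
  ... | inj₂ e'            | inj₂ (zu , vy)  = inj₂ (reach-trans (inj₂ [ e' ]) zu , vy)
  ... | inj₁ (refl , refl) | inj₁ q          = inj₂ (inj₁ refl , inj₂ q)
  ... | inj₁ (refl , refl) | inj₂ (_ , vy)   = inj₂ (inj₁ refl , vy)

module Faces {n : ℕ} (G : SimpleGraph n) where

  irreflexive : ∀ {x} → ¬ adj G x x ≡ true
  irreflexive {x} e with trans (sym e) (irrefl G x)
  ... | ()

  addArc-face : ∀ {F u v} → Face G F → adj G u v ≡ true → Root F v → ¬ Path F v u →
                Face G (addArc F u v)
  addArc-face {F} {u} {v} (inG , d , acyclic) e root noPath = inG' , d' , acyclic'
    where
    inG' : addArc F u v ⊆ᵈ adj G
    inG' a b e' with addArc-cases F u v a b e'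
    ... | inj₁ (refl , refl) = e
    ... | inj₂ f             = inG a b f
    d' : InDeg≤1 (addArc F u v)
    d' a a' b e₁ e₂ with addArc-cases F u v a b e₁ | addArc-cases F u v a' b e₂
    ... | inj₁ (a≡u , _)    | inj₁ (a'≡u , _) = trans a≡u (sym a'≡u)
    ... | inj₁ (_ , refl)   | inj₂ f          = ⊥-elim (root a' f)
    ... | inj₂ f            | inj₁ (_ , refl) = ⊥-elim (root a f)
    ... | inj₂ f            | inj₂ f'         = d a a' b f f'
    acyclic' : Acyclic (addArc F u v)
    acyclic' x c with path-addArc F u v c
    ... | inj₁ c'       = acyclic x c'
    ... | inj₂ (xu , vx) with reach-trans vx xu
    ...   | inj₁ refl = irreflexive e
    ...   | inj₂ p    = noPath p

  -- A face containing every arc out of x has x as a root: an arc u → x would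
  -- close the 2-cycle x → u → x.
  root-of-outArcs : ∀ {F x} → Face G F → (∀ b → adj G x b ≡ true → F x b ≡ true) → Root F x
  root-of-outArcs {x = x} (inG , _ , acyclic) out u e = acyclic u (e ∷ [ out u (symm G u x (inG u x e)) ])

  -- In a maximal face a root reaches each of its neighbours w, since otherwise
  -- the arc w → r could be added.
  root-reaches-neighbour : ∀ {F r w} → MaximalFace G F → Root F r → adj G r w ≡ true → ¬ ¬ Path F r w
  root-reaches-neighbour {F} {r} {w} (face , maximal) root e noPath =
    root w (maximal (addArc F w r) (addArc-face face (symm G r w e) root noPath)
                    (addArc-old F w r) w r (addArc-new F w r))

  uniqueRoot : DiamLe G 2 → ∀ {F r₁ r₂} → MaximalFace G F → Root F r₁ → Root F r₂ → r₁ ≡ r₂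
  uniqueRoot diam {F} {r₁} {r₂} mF@((_ , d , _) , _) root₁ root₂ = decidable-stable (r₁ ≟ r₂) (meet (diam r₁ r₂))
    where
    meet : DistLe G r₁ r₂ 2 → r₁ ≢ r₂ → ⊥
    meet (_ , _ , here) r₁≢r₂ = r₁≢r₂ refl
    meet (_ , _ , step e here) _ = root-reaches-neighbour mF root₁ e (noPathToRoot root₂)
    meet (_ , _ , step e₁ (step e₂ here)) r₁≢r₂ =
      root-reaches-neighbour mF root₁ e₁ λ p₁ →
      root-reaches-neighbour mF root₂ (symm G _ r₂ e₂) λ p₂ →
      r₁≢r₂ (roots-converge d root₁ root₂ p₁ p₂)
    meet (_ , s≤s (s≤s ()) , step _ (step _ (step _ _)))

  card-maximal : DiamLe G 2 → Fin n → ∀ {F} → MaximalFace G F → suc (card F) ≡ n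
  card-maximal diam z {F} mF@((_ , d , acyclic) , _) =
    let r , root = rootExists acyclic z in
    card-oneRoot d root (λ y y≢r → parentOf {F = F} (λ rooty → y≢r (uniqueRoot diam mF rooty root)))

  pure-of-diam : DiamLe G 2 → Fin n → PureDoubled G
  pure-of-diam diam z F F' mF mF' =
    suc-injective (trans (card-maximal diam z mF) (sym (card-maximal diam z mF')))

  _⊂_ : DEdgeSet n → DEdgeSet n → Set
  F ⊂ F' = F ⊆ᵈ F' × ∃[ u ] ∃[ v ] (F' u v ≡ true × F u v ≡ false)

  -- Faces have at most n arcs, so if every face with property P either yields
  -- the goal or can be strictly enlarged within P, the goal is reached.
  ascend : {P : DEdgeSet n → Set} {Goal : Set} → (∀ {F} → P F → Face G F) →
           (∀ {F} → P F → ¬ ¬ (Goal ⊎ ∃[ F' ] (P F' × F ⊂ F'))) →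
           ∀ {F} → P F → ¬ ¬ Goal
  ascend {P} {Goal} face enlarge {F} pF = go (suc n) pF (m≤n+m (suc n) (card F))
    where
    -- Fuel k with n < |F| + k bounds the number of remaining enlargements.
    go : ∀ k {F} → P F → n < card F + k → ¬ ¬ Goal
    go zero {F} pF n<|F| =
      ⊥-elim (≤⇒≯ (card≤n (proj₁ (proj₂ (face pF)))) (subst (n <_) (+-identityʳ (card F)) n<|F|))
    go (suc k) {F} pF n<|F|+k = enlarge pF >>= λ where
      (inj₁ goal) → pure goal
      (inj₂ (F' , pF' , F⊆F' , u , v , e' , e)) →
        go k pF' (<-≤-trans n<|F|+k (subst (_≤ card F' + k) (sym (+-suc (card F) k))
                                            (+-monoˡ-≤ k (card-< F⊆F' u v e' e))))

  extendToMaximal : ∀ {F} → Face G F → ¬ ¬ (∃[ F* ] (F ⊆ᵈ F* × MaximalFace G F*))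
  extendToMaximal {F} face = ascend proj₁ enlarge (face , λ _ _ e → e)
    where
    enlarge : ∀ {F'} → Face G F' × F ⊆ᵈ F' →
              ¬ ¬ (∃[ F* ] (F ⊆ᵈ F* × MaximalFace G F*) ⊎ ∃[ F'' ] ((Face G F'' × F ⊆ᵈ F'') × F' ⊂ F''))
    enlarge {F'} (face' , F⊆F') = ¬¬-map decide ¬¬-excluded-middle
      where
      decide : Dec (∃[ F'' ] (Face G F'' × F' ⊂ F'')) →
               ∃[ F* ] (F ⊆ᵈ F* × MaximalFace G F*) ⊎ ∃[ F'' ] ((Face G F'' × F ⊆ᵈ F'') × F' ⊂ F'')
      decide (yes (F'' , face'' , F'⊂F'')) =
        inj₂ (F'' , (face'' , λ a b e → proj₁ F'⊂F'' a b (F⊆F' a b e)) , F'⊂F'')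
      decide (no unenlargeable) = inj₁ (F' , F⊆F' , face' , maximal)
        where
        maximal : ∀ F'' → Face G F'' → F' ⊆ᵈ F'' → F'' ⊆ᵈ F'
        maximal F'' face'' F'⊆F'' a b e with F' a b in eq
        ... | true  = refl
        ... | false = ⊥-elim (unenlargeable (F'' , face'' , F'⊆F'' , a , b , e , eq))

  -- A face in which every vertex is reachable from r is a spanning tree: it is
  -- maximal (a new arc a → b either enters r, closing a cycle, or gives b a
  -- second parent) and r is its only root, so it has n − 1 arcs.
  spanning-maximal : ∀ {F r} → Face G F → (∀ y → Reach F r y) → MaximalFace G F × suc (card F) ≡ n
  spanning-maximal {F} {r} face@(_ , d , acyclic) reach = (face , maximal) , card-oneRoot d root parent
    where
    root : Root F r
    root a e = acyclic r (reach-snoc (reach a) e)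
    parent : ∀ y → y ≢ r → ∃[ p ] Arc F p y
    parent y y≢r with reach y
    ... | inj₁ r≡y = ⊥-elim (y≢r (sym r≡y))
    ... | inj₂ p   = lastArc p
    maximal : ∀ F' → Face G F' → F ⊆ᵈ F' → F' ⊆ᵈ F
    maximal F' (_ , d' , acyclic') F⊆F' a b e' with reach b
    ... | inj₁ refl = ⊥-elim (acyclic' r (reach-snoc (mapReach F⊆F' (reach a)) e'))
    ... | inj₂ p    = let c , e = lastArc p in
                      subst (λ t → F t b ≡ true) (d' c a b (F⊆F' c b e) e') e

  GrownFrom : Fin n → DEdgeSet n → Set
  GrownFrom r F = ∀ a b → Arc F a b → Reach F r a

  Frontier : Fin n → DEdgeSet n → Set
  Frontier r F = ∃[ u ] ∃[ v ] (adj G u v ≡ true × Reach F r u × ¬ Reach F r v)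

  SpanningTree : Set
  SpanningTree = ∃[ F ] (MaximalFace G F × suc (card F) ≡ n)

  -- A connected G has a spanning tree: grow a tree from r along frontier arcs
  -- until there is none; then connectivity makes every vertex reachable.
  spanningTree : Connected G → Fin n → ¬ ¬ SpanningTree
  spanningTree (_ , walk) r = ascend proj₁ grow {F = λ _ _ → false} (emptyFace , λ _ _ ())
    where
    emptyFace : Face G (λ _ _ → false)
    emptyFace = (λ _ _ ()) , (λ _ _ _ ()) , λ x c → noArc (proj₂ (firstArc c))
      where
      noArc : ¬ false ≡ true
      noArc ()
    grow : ∀ {F} → Face G F × GrownFrom r F →
           ¬ ¬ (SpanningTree ⊎ ∃[ F' ] ((Face G F' × GrownFrom r F') × F ⊂ F'))
    grow {F} (face , grown) = ¬¬-excluded-middle >>= continue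
      where
      -- Vertices outside the tree are roots, so an arc u → v from the tree to
      -- outside keeps F a face and a tree grown from r.
      rootv : ∀ {v} → ¬ Reach F r v → Root F v
      rootv ¬rv a e = ¬rv (inj₂ (reach-snoc (grown a _ e) e))
      face' : ∀ {u v} → adj G u v ≡ true → Reach F r u → ¬ Reach F r v → Face G (addArc F u v)
      face' e ru ¬rv = addArc-face face e (rootv ¬rv) λ p → ¬rv (grown _ _ (proj₂ (firstArc p)))
      grown' : ∀ {u v} → Reach F r u → GrownFrom r (addArc F u v)
      grown' {u} {v} ru a b e with addArc-cases F u v a b e
      ... | inj₁ (refl , _) = mapReach (addArc-old F u v) ru
      ... | inj₂ f          = mapReach (addArc-old F u v) (grown a b f)
      closed : ¬ Frontier r F → ∀ {a z k} → Walk G a z k → ¬ ¬ Reach F r a → ¬ ¬ Reach F r z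
      closed noFrontier here ra = ra
      closed noFrontier (step e w) ra =
        closed noFrontier w λ ¬rb → ra λ ra' → noFrontier (_ , _ , e , ra' , ¬rb)
      continue : Dec (Frontier r F) →
                 ¬ ¬ (SpanningTree ⊎ ∃[ F' ] ((Face G F' × GrownFrom r F') × F ⊂ F'))
      continue (yes (u , v , e , ru , ¬rv)) =
        pure (inj₂ (addArc F u v , (face' e ru ¬rv , grown' ru) ,
                    addArc-old F u v , u , v , addArc-new F u v , ¬-not (rootv ¬rv u)))
      continue (no noFrontier) =
        ¬¬-map (λ reachAll → inj₁ (F , spanning-maximal face reachAll))
               (¬¬-∀Fin (λ y → closed noFrontier (proj₂ (walk r y)) (pure (inj₁ refl))))

  module FarPair (x y : Fin n) (x≢y : x ≢ y) (x≁y : ¬ adj G x y ≡ true)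
                 (noCommon : ∀ w → adj G x w ≡ true → adj G w y ≡ true → ⊥) where

    outArcs : DEdgeSet n
    outArcs a b with a ≟ x | a ≟ y
    ... | no _ | no _ = false
    ... | _    | _    = adj G a b

    outArcs-cases : ∀ a b → Arc outArcs a b → (a ≡ x ⊎ a ≡ y) × adj G a b ≡ true
    outArcs-cases a b e with a ≟ x | a ≟ y
    ... | yes a≡x | _       = inj₁ a≡x , e
    ... | no _    | yes a≡y = inj₂ a≡y , e
    ... | no _    | no _    with e
    ...   | ()

    outArcs-x : ∀ b → adj G x b ≡ true → Arc outArcs x b
    outArcs-x b e with x ≟ x | x ≟ y
    ... | yes _ | _     = e
    ... | no x≢x | _    = ⊥-elim (x≢x refl)

    outArcs-y : ∀ b → adj G y b ≡ true → Arc outArcs y b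
    outArcs-y b e with y ≟ x | y ≟ y
    ... | yes _ | _      = e
    ... | no _  | yes _  = e
    ... | no _  | no y≢y = ⊥-elim (y≢y refl)

    -- No arc enters x or y, as they are non-adjacent; so no path has length ≥ 2.
    outArcs-head : ∀ a b → Arc outArcs a b → ¬ (b ≡ x ⊎ b ≡ y)
    outArcs-head a b e b∈xy with outArcs-cases a b e | b∈xy
    ... | inj₁ refl , e' | inj₁ refl = irreflexive e'
    ... | inj₁ refl , e' | inj₂ refl = x≁y e'
    ... | inj₂ refl , e' | inj₁ refl = x≁y (symm G y x e')
    ... | inj₂ refl , e' | inj₂ refl = irreflexive e'

    outArcs-face : Face G outArcs
    outArcs-face = (λ a b e → proj₂ (outArcs-cases a b e)) , inDeg≤1 , acyclic
      where
      inDeg≤1 : InDeg≤1 outArcs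
      inDeg≤1 a a' b e e' with outArcs-cases a b e | outArcs-cases a' b e'
      ... | inj₁ refl , _  | inj₁ refl , _   = refl
      ... | inj₂ refl , _  | inj₂ refl , _   = refl
      ... | inj₁ refl , ex | inj₂ refl , ey  = ⊥-elim (noCommon b ex (symm G y b ey))
      ... | inj₂ refl , ey | inj₁ refl , ex  = ⊥-elim (noCommon b ex (symm G y b ey))
      acyclic : Acyclic outArcs
      acyclic a c with lastArc c | firstArc c
      ... | p , last | b , first = outArcs-head p a last (proj₁ (outArcs-cases a b first))

    -- A maximal face containing outArcs has the two roots x, y, so ≤ n − 2 arcs,
    -- while a spanning tree is a maximal face with n − 1 arcs.
    impure : Connected G → ¬ PureDoubled G
    impure conn isPure = spanningTree conn x λ where
      (FA , maxA , |FA|+1≡n) → extendToMaximal outArcs-face λ where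
        (FB , out⊆FB , maxB@((_ , d , _) , _)) →
          let rootx = root-of-outArcs (proj₁ maxB) (λ b e → out⊆FB x b (outArcs-x b e))
              rooty = root-of-outArcs (proj₁ maxB) (λ b e → out⊆FB y b (outArcs-y b e))
              |FA|≡|FB| = isPure FA FB maxA maxB
          in 1+n≰n (subst (λ s → suc s ≤ n) (trans (cong suc (sym |FA|≡|FB|)) |FA|+1≡n)
                        (card-twoRoots d x≢y rootx rooty))

  diam-of-pure : Connected G → PureDoubled G → DiamLe G 2
  diam-of-pure conn isPure x y with x ≟ y
  ... | yes refl = 0 , z≤n , here
  ... | no x≢y with adj G x y ≟ᵇ true
  ...   | yes e = 1 , s≤s z≤n , step e here
  ...   | no x≁y with any? (λ w → (adj G x w ≟ᵇ true) ×-dec (adj G w y ≟ᵇ true))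
  ...     | yes (w , e₁ , e₂) = 2 , s≤s (s≤s z≤n) , step e₁ (step e₂ here)
  ...     | no noCommon =
    ⊥-elim (FarPair.impure x y x≢y x≁y (λ w e₁ e₂ → noCommon (w , e₁ , e₂)) conn isPure)

mainTheorem6 : (n : ℕ) (G : SimpleGraph n) → Connected G →
               (PureDoubled G → DiamLe G 2) × (DiamLe G 2 → PureDoubled G)
mainTheorem6 zero    G (() , _)
mainTheorem6 (suc m) G conn = diam-of-pure conn , λ diam → pure-of-diam diam zero
  where open Faces G
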